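{- For $n\ge1$, the unreduced Euler characteristic of $\mathrm{Hom}(B_n)$ is $$\chi_n=\sum_{k=0}^{\lfloor n/2\rfloor}(-1)^k\frac{n!}{2^k}\binom{n-k}{k}.$$
   Context: $B_n$ is the Boolean lattice of subsets of $\{1,\ldots,n\}$, graded of rank $n$; $C_n$ is the chain $0<1<\cdots<n$. $\mathrm{Hom}(B_n)=\mathrm{Hom}(C_n,B_n)$ is the subcomplex of the product of simplices $\prod_{p=0}^n\Delta_{B_n}$ whose cells are the tuples $(X_0,\ldots,X_n)$ of nonempty subsets of $B_n$ such that every map $\eta$ with $\eta(p)\in X_p$ is strictly order-preserving from $C_n$ to $B_n$ (the cell being the product of simplices $\Delta_{X_p}$); its vertices are the maximal chains of $B_n$, i.e. permutations of $\{1,\ldots,n\}$. -}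

module Defs where

open import Data.Bool using (Bool; true; false; if_then_else_; _∧_)
import Data.Bool
import Data.Nat
open import Data.Nat using (ℕ; zero; suc; _∸_; _^_; _/_; _+_; _!)
open import Data.Nat.Properties using (m^n≢0)
open import Data.Nat.Combinatorics using (_C_)
open import Data.Integer as ℤ using (ℤ; +_)
open import Data.Fin using (Fin)
open import Data.Fin.Subset using (Subset; _⊂_; inside; outside)
open import Data.Fin.Subset.Properties using (_⊂?_)
open import Data.List as L using (List; []; _∷_; length; map; filter; concatMap; allFin; upTo)
open import Data.Vec as V using (Vec; lookup)
import Data.Fin as F
open import Relation.Nullary.Decidable using (⌊_⌋)

-- All elements of the Boolean lattice B_n (subsets of {1..n} as Subset n).
allElems : (n : ℕ) → List (Subset n)
allElems zero = V.[] ∷ []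
allElems (suc n) = map (outside V.∷_) (allElems n) L.++ map (inside V.∷_) (allElems n)

sublists : {A : Set} → List A → List (List A)
sublists [] = [] ∷ []
sublists (x ∷ xs) = sublists xs L.++ map (x ∷_) (sublists xs)

nonemptySubsetsOfB : (n : ℕ) → List (List (Subset n))
nonemptySubsetsOfB n = filter (λ X → 1 Data.Nat.≤? length X) (sublists (allElems n))

tuples : {A : Set} → List A → (m : ℕ) → List (Vec A m)
tuples xs zero = V.[] ∷ []
tuples xs (suc m) = concatMap (λ x → map (x V.∷_) (tuples xs m)) xs

allL : {A : Set} → (A → Bool) → List A → Bool
allL P [] = true
allL P (x ∷ xs) = P x ∧ allL P xs

-- (X_0,...,X_n) is a cell of Hom(C_n,B_n): every η with η(p) ∈ X_p is strictly
-- order-preserving, i.e. for all p < q, all a ∈ X_p, b ∈ X_q, we have a ⊂ b.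
isCell : (n : ℕ) → Vec (List (Subset n)) (suc n) → Bool
isCell n X =
  allL (λ p → allL (λ q →
    if ⌊ p F.<? q ⌋
    then allL (λ a → allL (λ b → ⌊ a ⊂? b ⌋) (lookup X q)) (lookup X p)
    else true) (allFin (suc n))) (allFin (suc n))

cells : (n : ℕ) → List (Vec (List (Subset n)) (suc n))
cells n = filter (λ X → isCell n X Data.Bool.≟ true) (tuples (nonemptySubsetsOfB n) (suc n))

-- Dimension of the cell Δ_{X_0} × ... × Δ_{X_n}: Σ_p (|X_p| - 1).
dim : {n : ℕ} → Vec (List (Subset n)) (suc n) → ℕ
dim X = V.foldr (λ _ → ℕ) (λ Xp d → (length Xp ∸ 1) + d) 0 X

sign : ℕ → ℤ
sign zero = + 1
sign (suc k) = ℤ.- sign k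

eulerHom : ℕ → ℤ
eulerHom n = L.foldr ℤ._+_ (+ 0) (map (λ X → sign (dim X)) (cells n))

fact/2^ : ℕ → ℕ → ℕ
fact/2^ n k = _/_ (n !) (2 ^ k) {{m^n≢0 2 k}}

formula : ℕ → ℤ
formula n = L.foldr ℤ._+_ (+ 0)
  (map (λ k → sign k ℤ.* (+ (fact/2^ n k Data.Nat.* ((n ∸ k) C k)))) (upTo (suc (n / 2))))

module Submission where

-- Both sides are shown to equal χ n, where χ 0 = 1 and χ (m+1) = (m+1) χ m − C(m+1,2) χ (m−1)
-- (with χ (−1) = 0).  For the closed formula this is a computation: the coefficients
-- a(n,k) = (n!/2^k) C(n−k,k) satisfy a(n+2,k+1) = (n+2) a(n+1,k+1) + C(n+2,2) a(n,k) by
-- Pascal's rule, so the alternating sums satisfy the recurrence of χ.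
--
-- For Hom(B_n): since C_n has n+1 elements and B_n has rank n, in a cell (X_0, …, X_n) every
-- X_p consists of rank-p sets, each containing the join of X_0, …, X_{p−1}; cells are exactly
-- such "graded" tuples.  The alternating count Φ m ℓ u of graded m-tuples starting at rank ℓ
-- above u (m + ℓ = n + 1) expands along the first entry X, a nonempty set of rank-ℓ elements
-- above u.  If u has rank ℓ − 1 these elements are the n − |u| covers of u, the join of k of
-- them has rank |u| + k, and only k = 1, 2 contribute; this is χ's recurrence, whence
-- Φ m ℓ u = χ m.  If u has rank ℓ, X = {u} is forced and Φ m ℓ u = χ (m−1).
-- Finally χ(Hom(B_n)) = Φ (n+1) 0 ∅ = χ n.

open import Defs
open import Data.Bool using (Bool; true; false; if_then_else_; T; T?; _∧_)
import Data.Bool as Bool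
open import Data.Bool.Properties using (T-∧)
open import Data.Empty using (⊥-elim)
open import Data.Fin as Fin using (Fin; zero; suc)
open import Data.Fin.Subset using (Subset; _⊆_; _⊂_; _∪_; _∩_; ∣_∣; ⊥; inside; outside)
open import Data.Fin.Subset.Properties as Subsetₚ using (_⊆?_; _⊂?_)
open import Data.Integer as ℤ using (ℤ; +_)
import Data.Integer.Properties as ℤₚ
import Data.Integer.Tactic.RingSolver as ℤ-Solver
open import Data.List
  using (List; []; _∷_; _++_; map; foldr; concatMap; filter; filterᵇ; length; allFin; applyUpTo)
open import Data.List.Membership.Propositional using (_∈_; _∉_)
open import Data.List.Membership.Propositional.Properties
  using (∈-allFin; ∈-map⁻; ∈-++⁻; ∈-concat⁻′; ∈-filter⁻)
open import Data.List.Properties using (map-∘; filter-++; filter-none; length-++; length-map)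
open import Data.List.Relation.Unary.All as All using ([])
open import Data.List.Relation.Unary.AllPairs using ([]; _∷_)
open import Data.List.Relation.Unary.Any using (here; there)
open import Data.List.Relation.Unary.Unique.Propositional using (Unique)
import Data.List.Relation.Unary.Unique.Propositional.Properties as Uniqueₚ
open import Data.Nat as ℕ using (ℕ; zero; suc; _+_; _*_; _∸_; _^_; _/_; _!; _≤_; _<_; z≤n; s≤s)
import Data.Nat.Properties as ℕₚ
import Data.Nat.Tactic.RingSolver as ℕ-Solver
open import Data.Nat.Combinatorics using (_C_; k>n⇒nCk≡0; nCk+nC[k+1]≡[n+1]C[k+1]; nC1≡n)
open import Data.Nat.DivMod using (m/n*n≡m; m*n/n≡m; n/1≡n; m/n≤m; /-monoˡ-≤)
open import Data.Nat.Divisibility as Div using (divides; ∣-refl; ∣-trans; *-monoʳ-∣; m≤n⇒m!∣n!)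
open import Data.Product using (_×_; _,_; proj₁; proj₂; ∃-syntax)
open import Data.Sum using (_⊎_; inj₁; inj₂)
open import Data.Vec as Vec using (Vec; lookup; _∷_) renaming ([] to [])
import Data.Vec.Properties as Vecₚ
open import Function using (_∘_; id)
open import Function.Bundles using (Equivalence)
open import Relation.Binary.PropositionalEquality
open import Relation.Nullary using (Dec; yes; no; does; ¬_; contradiction)
open import Relation.Nullary.Decidable using (⌊_⌋; toWitness; fromWitness)
open import Relation.Unary using (Decidable)

private variable A B : Set

-- Σ xs f is the sum of f over the list xs.  Both eulerHom and formula are sums of exactly
-- this shape, so the lemmas below apply to them without any unfolding.
Σ : List A → (A → ℤ) → ℤ
Σ xs f = foldr ℤ._+_ (+ 0) (map f xs)

Σ-++ : (xs ys : List A) (f : A → ℤ) → Σ (xs ++ ys) f ≡ Σ xs f ℤ.+ Σ ys f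
Σ-++ []       ys f = sym (ℤₚ.+-identityˡ _)
Σ-++ (x ∷ xs) ys f = trans (cong (λ s → f x ℤ.+ s) (Σ-++ xs ys f)) (sym (ℤₚ.+-assoc (f x) _ _))

Σ-map : (g : A → B) (xs : List A) (f : B → ℤ) → Σ (map g xs) f ≡ Σ xs (f ∘ g)
Σ-map g xs f = cong (foldr ℤ._+_ (+ 0)) (sym (map-∘ xs))

Σ-concatMap : (g : A → List B) (xs : List A) (f : B → ℤ) →
  Σ (concatMap g xs) f ≡ Σ xs (λ x → Σ (g x) f)
Σ-concatMap g []       f = refl
Σ-concatMap g (x ∷ xs) f =
  trans (Σ-++ (g x) (concatMap g xs) f) (cong (λ s → Σ (g x) f ℤ.+ s) (Σ-concatMap g xs f))

Σ-cong : (xs : List A) {f g : A → ℤ} → (∀ {x} → x ∈ xs → f x ≡ g x) → Σ xs f ≡ Σ xs g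
Σ-cong []       f≗g = refl
Σ-cong (x ∷ xs) f≗g = cong₂ ℤ._+_ (f≗g (here refl)) (Σ-cong xs (f≗g ∘ there))

Σ-zero : (xs : List A) → Σ xs (λ _ → + 0) ≡ + 0
Σ-zero []       = refl
Σ-zero (x ∷ xs) = trans (ℤₚ.+-identityˡ _) (Σ-zero xs)

Σ-*ˡ : (c : ℤ) (xs : List A) (f : A → ℤ) → Σ xs (λ x → c ℤ.* f x) ≡ c ℤ.* Σ xs f
Σ-*ˡ c []       f = sym (ℤₚ.*-zeroʳ c)
Σ-*ˡ c (x ∷ xs) f =
  trans (cong (λ s → c ℤ.* f x ℤ.+ s) (Σ-*ˡ c xs f)) (sym (ℤₚ.*-distribˡ-+ c (f x) _))

Σ-filter : {P : A → Set} (P? : Decidable P) (xs : List A) (f : A → ℤ) →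
  Σ (filter P? xs) f ≡ Σ xs (λ x → if does (P? x) then f x else + 0)
Σ-filter P? []       f = refl
Σ-filter P? (x ∷ xs) f with does (P? x)
... | true  = cong (λ s → f x ℤ.+ s) (Σ-filter P? xs f)
... | false = trans (Σ-filter P? xs f) (sym (ℤₚ.+-identityˡ _))

Σ-sublists-∷ : (x : A) (xs : List A) (h : List A → ℤ) →
  Σ (sublists (x ∷ xs)) h ≡ Σ (sublists xs) h ℤ.+ Σ (sublists xs) (h ∘ (x ∷_))
Σ-sublists-∷ x xs h =
  trans (Σ-++ (sublists xs) _ h) (cong (λ s → Σ (sublists xs) h ℤ.+ s) (Σ-map (x ∷_) (sublists xs) h))

restrict : (A → Bool) → (List A → ℤ) → List A → ℤ
restrict P h X = if allL P X then h X else + 0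

restrict-accept : (P : A → Bool) (h : List A → ℤ) {x : A} → P x ≡ true →
  ∀ X → restrict P h (x ∷ X) ≡ restrict P (h ∘ (x ∷_)) X
restrict-accept P h Px X rewrite Px = refl

restrict-reject : (P : A → Bool) (h : List A → ℤ) {x : A} → P x ≡ false →
  ∀ X → restrict P h (x ∷ X) ≡ + 0
restrict-reject P h Px X rewrite Px = refl

Σ-sublists-filter : (P : A → Bool) (xs : List A) (h : List A → ℤ) →
  Σ (sublists xs) (restrict P h) ≡ Σ (sublists (filterᵇ P xs)) h
Σ-sublists-filter P []       h = refl
Σ-sublists-filter P (x ∷ xs) h with P x in Px
... | true  = begin
  Σ (sublists (x ∷ xs)) (restrict P h)
    ≡⟨ Σ-sublists-∷ x xs (restrict P h) ⟩
  Σ (sublists xs) (restrict P h) ℤ.+ Σ (sublists xs) (restrict P h ∘ (x ∷_))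
    ≡⟨ cong (λ s → Σ (sublists xs) (restrict P h) ℤ.+ s)
            (Σ-cong (sublists xs) (λ {X} _ → restrict-accept P h Px X)) ⟩
  Σ (sublists xs) (restrict P h) ℤ.+ Σ (sublists xs) (restrict P (h ∘ (x ∷_)))
    ≡⟨ cong₂ ℤ._+_ (Σ-sublists-filter P xs h) (Σ-sublists-filter P xs (h ∘ (x ∷_))) ⟩
  Σ (sublists (filterᵇ P xs)) h ℤ.+ Σ (sublists (filterᵇ P xs)) (h ∘ (x ∷_))
    ≡⟨ sym (Σ-sublists-∷ x (filterᵇ P xs) h) ⟩
  Σ (sublists (x ∷ filterᵇ P xs)) h ∎
  where open ≡-Reasoning
... | false = begin
  Σ (sublists (x ∷ xs)) (restrict P h)
    ≡⟨ Σ-sublists-∷ x xs (restrict P h) ⟩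
  Σ (sublists xs) (restrict P h) ℤ.+ Σ (sublists xs) (restrict P h ∘ (x ∷_))
    ≡⟨ cong₂ ℤ._+_ (Σ-sublists-filter P xs h)
             (trans (Σ-cong (sublists xs) (λ {X} _ → restrict-reject P h Px X)) (Σ-zero (sublists xs))) ⟩
  Σ (sublists (filterᵇ P xs)) h ℤ.+ + 0
    ≡⟨ ℤₚ.+-identityʳ _ ⟩
  Σ (sublists (filterᵇ P xs)) h ∎
  where open ≡-Reasoning

Σ-sublists-by-size : (xs : List A) (g : ℕ → ℤ) → (∀ j → g (3 + j) ≡ + 0) →
  Σ (sublists xs) (g ∘ length) ≡ g 0 ℤ.+ + length xs ℤ.* g 1 ℤ.+ + (length xs C 2) ℤ.* g 2
Σ-sublists-by-size []       g g≥3 = base (g 0) (g 1) (g 2)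
  where
  base : ∀ a b c → a ℤ.+ + 0 ≡ a ℤ.+ + 0 ℤ.* b ℤ.+ + 0 ℤ.* c
  base = ℤ-Solver.solve-∀
Σ-sublists-by-size (x ∷ xs) g g≥3 = begin
  Σ (sublists (x ∷ xs)) (g ∘ length)
    ≡⟨ Σ-sublists-∷ x xs (g ∘ length) ⟩
  Σ (sublists xs) (g ∘ length) ℤ.+ Σ (sublists xs) (g ∘ suc ∘ length)
    ≡⟨ cong₂ ℤ._+_ (Σ-sublists-by-size xs g g≥3) (Σ-sublists-by-size xs (g ∘ suc) (g≥3 ∘ suc)) ⟩
  (g 0 ℤ.+ + l ℤ.* g 1 ℤ.+ + c ℤ.* g 2) ℤ.+ (g 1 ℤ.+ + l ℤ.* g 2 ℤ.+ + c ℤ.* g 3)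
    ≡⟨ cong (λ t → (g 0 ℤ.+ + l ℤ.* g 1 ℤ.+ + c ℤ.* g 2) ℤ.+ (g 1 ℤ.+ + l ℤ.* g 2 ℤ.+ + c ℤ.* t)) (g≥3 0) ⟩
  (g 0 ℤ.+ + l ℤ.* g 1 ℤ.+ + c ℤ.* g 2) ℤ.+ (g 1 ℤ.+ + l ℤ.* g 2 ℤ.+ + c ℤ.* + 0)
    ≡⟨ collect (g 0) (g 1) (g 2) (+ l) (+ c) ⟩
  g 0 ℤ.+ (+ 1 ℤ.+ + l) ℤ.* g 1 ℤ.+ (+ l ℤ.+ + c) ℤ.* g 2
    ≡⟨ cong₂ (λ s t → g 0 ℤ.+ s ℤ.* g 1 ℤ.+ t ℤ.* g 2) (sym (ℤₚ.pos-+ 1 l)) (trans (sym (ℤₚ.pos-+ l c)) (cong +_ pascal)) ⟩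
  g 0 ℤ.+ + suc l ℤ.* g 1 ℤ.+ + (suc l C 2) ℤ.* g 2 ∎
  where
  open ≡-Reasoning
  l : ℕ
  l = length xs
  c : ℕ
  c = l C 2
  pascal : l + c ≡ suc l C 2
  pascal = trans (cong (_+ c) (sym (nC1≡n l))) (nCk+nC[k+1]≡[n+1]C[k+1] l 1)
  collect : ∀ a b d p q → (a ℤ.+ p ℤ.* b ℤ.+ q ℤ.* d) ℤ.+ (b ℤ.+ p ℤ.* d ℤ.+ q ℤ.* + 0)
                        ≡ a ℤ.+ (+ 1 ℤ.+ p) ℤ.* b ℤ.+ (p ℤ.+ q) ℤ.* d
  collect = ℤ-Solver.solve-∀

-- The sequence χ 0 = 1, χ (m+1) = (m+1) χ m − C(m+1, 2) χ (m−1), with χ₋ m standing for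
-- χ (m−1) and χ (−1) = 0.  Both sides of the theorem equal χ n.
mutual
  χ : ℕ → ℤ
  χ zero    = + 1
  χ (suc m) = + suc m ℤ.* χ m ℤ.- + (suc m C 2) ℤ.* χ₋ m

  χ₋ : ℕ → ℤ
  χ₋ zero    = + 0
  χ₋ (suc m) = χ m

Σ< : ℕ → (ℕ → ℤ) → ℤ
Σ< zero    g = + 0
Σ< (suc N) g = g 0 ℤ.+ Σ< N (g ∘ suc)

Σ-applyUpTo : (f : ℕ → A) (g : A → ℤ) (N : ℕ) → Σ (applyUpTo f N) g ≡ Σ< N (g ∘ f)
Σ-applyUpTo f g zero    = refl
Σ-applyUpTo f g (suc N) = cong (λ s → g (f 0) ℤ.+ s) (Σ-applyUpTo (f ∘ suc) g N)

Σ<-stable : (g : ℕ → ℤ) (N M : ℕ) → (∀ k → N ≤ k → g k ≡ + 0) → N ≤ M → Σ< M g ≡ Σ< N g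
Σ<-stable g zero    zero    vanish _         = refl
Σ<-stable g zero    (suc M) vanish _         =
  cong₂ ℤ._+_ (vanish 0 z≤n) (Σ<-stable (g ∘ suc) zero M (λ k _ → vanish (suc k) z≤n) z≤n)
Σ<-stable g (suc N) (suc M) vanish (s≤s N≤M) =
  cong (λ s → g 0 ℤ.+ s) (Σ<-stable (g ∘ suc) N M (λ k N≤k → vanish (suc k) (s≤s N≤k)) N≤M)

Σ<-linear : (p q : ℤ) (f h : ℕ → ℤ) (N : ℕ) →
  Σ< N (λ k → p ℤ.* f k ℤ.- q ℤ.* h k) ≡ p ℤ.* Σ< N f ℤ.- q ℤ.* Σ< N h
Σ<-linear p q f h zero    = zero-identity p q
  where
  zero-identity : ∀ p q → + 0 ≡ p ℤ.* + 0 ℤ.- q ℤ.* + 0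
  zero-identity = ℤ-Solver.solve-∀
Σ<-linear p q f h (suc N) = begin
  (p ℤ.* f 0 ℤ.- q ℤ.* h 0) ℤ.+ Σ< N (λ k → p ℤ.* f (suc k) ℤ.- q ℤ.* h (suc k))
    ≡⟨ cong (λ s → (p ℤ.* f 0 ℤ.- q ℤ.* h 0) ℤ.+ s) (Σ<-linear p q (f ∘ suc) (h ∘ suc) N) ⟩
  (p ℤ.* f 0 ℤ.- q ℤ.* h 0) ℤ.+ (p ℤ.* Σ< N (f ∘ suc) ℤ.- q ℤ.* Σ< N (h ∘ suc))
    ≡⟨ regroup p q (f 0) (h 0) (Σ< N (f ∘ suc)) (Σ< N (h ∘ suc)) ⟩
  p ℤ.* (f 0 ℤ.+ Σ< N (f ∘ suc)) ℤ.- q ℤ.* (h 0 ℤ.+ Σ< N (h ∘ suc)) ∎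
  where
  open ≡-Reasoning
  regroup : ∀ p q a b s t → (p ℤ.* a ℤ.- q ℤ.* b) ℤ.+ (p ℤ.* s ℤ.- q ℤ.* t)
                          ≡ p ℤ.* (a ℤ.+ s) ℤ.- q ℤ.* (b ℤ.+ t)
  regroup = ℤ-Solver.solve-∀

Σ<-cong : (f g : ℕ → ℤ) (N : ℕ) → (∀ k → f k ≡ g k) → Σ< N f ≡ Σ< N g
Σ<-cong f g zero    f≗g = refl
Σ<-cong f g (suc N) f≗g = cong₂ ℤ._+_ (f≗g 0) (Σ<-cong (f ∘ suc) (g ∘ suc) N (f≗g ∘ suc))

Σ<-recurrence : (p q : ℤ) (f g h : ℕ → ℤ) (N : ℕ) → g 0 ≡ p ℤ.* f 0 →
  (∀ k → g (suc k) ≡ p ℤ.* f (suc k) ℤ.- q ℤ.* h k) →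
  Σ< (suc N) g ≡ p ℤ.* Σ< (suc N) f ℤ.- q ℤ.* Σ< N h
Σ<-recurrence p q f g h N g-zero g-suc = begin
  g 0 ℤ.+ Σ< N (g ∘ suc)
    ≡⟨ cong₂ ℤ._+_ g-zero (trans (Σ<-cong _ _ N g-suc) (Σ<-linear p q (f ∘ suc) h N)) ⟩
  p ℤ.* f 0 ℤ.+ (p ℤ.* Σ< N (f ∘ suc) ℤ.- q ℤ.* Σ< N h)
    ≡⟨ regroup p q (f 0) (Σ< N (f ∘ suc)) (Σ< N h) ⟩
  p ℤ.* (f 0 ℤ.+ Σ< N (f ∘ suc)) ℤ.- q ℤ.* Σ< N h ∎
  where
  open ≡-Reasoning
  regroup : ∀ p q a s t → p ℤ.* a ℤ.+ (p ℤ.* s ℤ.- q ℤ.* t) ≡ p ℤ.* (a ℤ.+ s) ℤ.- q ℤ.* t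
  regroup = ℤ-Solver.solve-∀

-- 2^k divides (2k)!, since (2k+2)! = (2k+2)(2k+1)(2k)! = 2 (k+1)(2k+1) (2k)!.
2^k∣[2k]! : ∀ k → 2 ^ k Div.∣ (k + k) !
2^k∣[2k]! zero    = ∣-refl
2^k∣[2k]! (suc k) = ∣-trans (*-monoʳ-∣ 2 (2^k∣[2k]! k)) (divides (suc k * suc (k + k)) unfold)
  where
  factor : ∀ k f → suc (suc (k + k)) * (suc (k + k) * f) ≡ (suc k * suc (k + k)) * (2 * f)
  factor = ℕ-Solver.solve-∀
  unfold : (suc k + suc k) ! ≡ (suc k * suc (k + k)) * (2 * (k + k) !)
  unfold = trans (cong (λ m → suc m !) (ℕₚ.+-suc k k)) (factor k ((k + k) !))

fact/2^-exact : ∀ n k → k + k ≤ n → fact/2^ n k * 2 ^ k ≡ n !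
fact/2^-exact n k 2k≤n =
  m/n*n≡m {{ℕₚ.m^n≢0 2 k}} (∣-trans (2^k∣[2k]! k) (m≤n⇒m!∣n! 2k≤n))

C-vanishes : ∀ n k → n < k + k → (n ∸ k) C k ≡ 0
C-vanishes n zero    ()
C-vanishes n (suc k) n<2k = k>n⇒nCk≡0 (ℕₚ.m<n+o⇒m∸n<o n (suc k) n<2k)

coeff : ℕ → ℕ → ℕ
coeff n k = fact/2^ n k * ((n ∸ k) C k)

coeff-scaled : ∀ n k → 2 ^ k * coeff n k ≡ n ! * ((n ∸ k) C k)
coeff-scaled n k with k + k ℕ.≤? n
... | yes 2k≤n = begin
  2 ^ k * (fact/2^ n k * c) ≡⟨ reassoc (2 ^ k) (fact/2^ n k) c ⟩
  fact/2^ n k * 2 ^ k * c   ≡⟨ cong (_* c) (fact/2^-exact n k 2k≤n) ⟩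
  n ! * c                   ∎
  where
  open ≡-Reasoning
  c : ℕ
  c = (n ∸ k) C k
  reassoc : ∀ a b c → a * (b * c) ≡ b * a * c
  reassoc = ℕ-Solver.solve-∀
... | no 2k≰n = begin
  2 ^ k * (fact/2^ n k * ((n ∸ k) C k)) ≡⟨ cong (λ c → 2 ^ k * (fact/2^ n k * c)) vanishes ⟩
  2 ^ k * (fact/2^ n k * 0)             ≡⟨ both-zero (2 ^ k) (fact/2^ n k) (n !) ⟩
  n ! * 0                               ≡⟨ cong (n ! *_) (sym vanishes) ⟩
  n ! * ((n ∸ k) C k)                   ∎
  where
  open ≡-Reasoning
  vanishes : (n ∸ k) C k ≡ 0
  vanishes = C-vanishes n k (ℕₚ.≰⇒> 2k≰n)
  both-zero : ∀ a b c → a * (b * 0) ≡ c * 0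
  both-zero = ℕ-Solver.solve-∀

2*C2 : ∀ n → 2 * (suc n C 2) ≡ suc n * n
2*C2 zero    = refl
2*C2 (suc n) = begin
  2 * (suc (suc n) C 2)        ≡⟨ cong (2 *_) (sym (nCk+nC[k+1]≡[n+1]C[k+1] (suc n) 1)) ⟩
  2 * (suc n C 1 + suc n C 2)  ≡⟨ cong (λ c → 2 * (c + suc n C 2)) (nC1≡n (suc n)) ⟩
  2 * (suc n + suc n C 2)      ≡⟨ ℕₚ.*-distribˡ-+ 2 (suc n) _ ⟩
  2 * suc n + 2 * (suc n C 2)  ≡⟨ cong (λ c → 2 * suc n + c) (2*C2 n) ⟩
  2 * suc n + suc n * n        ≡⟨ expand n ⟩
  suc (suc n) * suc n          ∎
  where
  open ≡-Reasoning
  expand : ∀ n → 2 * suc n + suc n * n ≡ suc (suc n) * suc n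
  expand = ℕ-Solver.solve-∀

pascal-shifted : ∀ n k → (suc n ∸ k) C suc k ≡ (n ∸ k) C k + (n ∸ k) C suc k
pascal-shifted n k with k ℕ.≤? n
... | yes k≤n = trans (cong (_C suc k) (ℕₚ.+-∸-assoc 1 k≤n))
                      (sym (nCk+nC[k+1]≡[n+1]C[k+1] (n ∸ k) k))
... | no k≰n  = begin
  (suc n ∸ k) C suc k                ≡⟨ k>n⇒nCk≡0 (s≤s (ℕₚ.≤-trans (ℕₚ.m∸n≤m (suc n) k) n<k)) ⟩
  0                                  ≡⟨ sym (k>n⇒nCk≡0 (ℕₚ.≤-trans (s≤s (ℕₚ.m∸n≤m n k)) n<k)) ⟩
  (n ∸ k) C k                        ≡⟨ sym (ℕₚ.+-identityʳ _) ⟩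
  (n ∸ k) C k + 0                    ≡⟨ cong (λ c → (n ∸ k) C k + c) (sym (k>n⇒nCk≡0 (ℕₚ.≤-trans (s≤s (ℕₚ.m∸n≤m n k)) (ℕₚ.m≤n⇒m≤1+n n<k)))) ⟩
  (n ∸ k) C k + (n ∸ k) C suc k      ∎
  where
  open ≡-Reasoning
  n<k : n < k
  n<k = ℕₚ.≰⇒> k≰n

-- The coefficients obey
--   coeff (n+2) (k+1) = (n+2) coeff (n+1) (k+1) + C(n+2, 2) coeff n k,
-- which follows from Pascal's rule after clearing the denominator 2^(k+1).
coeff-rec : ∀ n k → coeff (2 + n) (suc k) ≡ (2 + n) * coeff (1 + n) (suc k) + ((2 + n) C 2) * coeff n k
coeff-rec n k = ℕₚ.*-cancelˡ-≡ _ _ (2 ^ suc k) {{ℕₚ.m^n≢0 2 (suc k)}} (begin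
  2 ^ suc k * coeff (2 + n) (suc k)
    ≡⟨ coeff-scaled (2 + n) (suc k) ⟩
  (2 + n) ! * ((suc n ∸ k) C suc k)
    ≡⟨ cong ((2 + n) ! *_) (pascal-shifted n k) ⟩
  (2 + n) ! * (c₀ + c₁)
    ≡⟨ split (n !) c₀ c₁ n ⟩
  (2 + n) * ((1 + n) ! * c₁) + (suc (suc n) * suc n) * (n ! * c₀)
    ≡⟨ cong₂ (λ s t → (2 + n) * s + t) (sym (coeff-scaled (1 + n) (suc k)))
             (cong₂ _*_ (sym (2*C2 (suc n))) (sym (coeff-scaled n k))) ⟩
  (2 + n) * (2 ^ suc k * coeff (1 + n) (suc k)) + (2 * ((2 + n) C 2)) * (2 ^ k * coeff n k)
    ≡⟨ collect (2 + n) (2 ^ k) (coeff (1 + n) (suc k)) ((2 + n) C 2) (coeff n k) ⟩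
  2 ^ suc k * ((2 + n) * coeff (1 + n) (suc k) + ((2 + n) C 2) * coeff n k) ∎)
  where
  open ≡-Reasoning
  c₀ c₁ : ℕ
  c₀ = (n ∸ k) C k
  c₁ = (n ∸ k) C suc k
  split : ∀ f x y n → (suc (suc n) * (suc n * f)) * (x + y)
                    ≡ suc (suc n) * ((suc n * f) * y) + (suc (suc n) * suc n) * (f * x)
  split = ℕ-Solver.solve-∀
  collect : ∀ m p b c d → m * ((2 * p) * b) + (2 * c) * (p * d) ≡ (2 * p) * (m * b + c * d)
  collect = ℕ-Solver.solve-∀

term : ℕ → ℕ → ℤ
term n k = sign k ℤ.* + coeff n k

formula-as-Σ< : ∀ n → formula n ≡ Σ< (suc (n / 2)) (term n)
formula-as-Σ< n = Σ-applyUpTo id (term n) (suc (n / 2))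

term-zero : ∀ n → term n 0 ≡ + (n !)
term-zero n = trans (ℤₚ.*-identityˡ _) (cong +_ (trans (ℕₚ.*-identityʳ _) (n/1≡n (n !))))

2k≤n⇒k≤n/2 : ∀ {n k} → k + k ≤ n → k ≤ n / 2
2k≤n⇒k≤n/2 {n} {k} 2k≤n = begin
  k                 ≡⟨ sym (m*n/n≡m k 2) ⟩
  k * 2 / 2         ≡⟨ cong (_/ 2) (ℕₚ.*-comm k 2) ⟩
  (k + (k + 0)) / 2 ≡⟨ cong (λ m → (k + m) / 2) (ℕₚ.+-identityʳ k) ⟩
  (k + k) / 2       ≤⟨ /-monoˡ-≤ 2 2k≤n ⟩
  n / 2             ∎
  where open ℕₚ.≤-Reasoning

term-vanishes : ∀ n k → n / 2 < k → term n k ≡ + 0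
term-vanishes n k n/2<k = begin
  sign k ℤ.* + (fact/2^ n k * ((n ∸ k) C k)) ≡⟨ cong (λ c → sign k ℤ.* + (fact/2^ n k * c)) (C-vanishes n k n<2k) ⟩
  sign k ℤ.* + (fact/2^ n k * 0)             ≡⟨ cong (λ c → sign k ℤ.* + c) (ℕₚ.*-zeroʳ (fact/2^ n k)) ⟩
  sign k ℤ.* + 0                             ≡⟨ ℤₚ.*-zeroʳ (sign k) ⟩
  + 0                                        ∎
  where
  open ≡-Reasoning
  n<2k : n < k + k
  n<2k = ℕₚ.≰⇒> (λ 2k≤n → ℕₚ.<⇒≱ n/2<k (2k≤n⇒k≤n/2 2k≤n))

-- The summands inherit the recurrence of the coefficients, the sign flip
-- turning the “+” into a “−”.
term-rec : ∀ n k → term (2 + n) (suc k)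
         ≡ + (2 + n) ℤ.* term (1 + n) (suc k) ℤ.- + ((2 + n) C 2) ℤ.* term n k
term-rec n k = begin
  ℤ.- sign k ℤ.* + coeff (2 + n) (suc k)
    ≡⟨ cong (λ c → ℤ.- sign k ℤ.* + c) (coeff-rec n k) ⟩
  ℤ.- sign k ℤ.* + ((2 + n) * c₁ + ((2 + n) C 2) * c₀)
    ≡⟨ cong (λ c → ℤ.- sign k ℤ.* c) (ℤₚ.pos-+ ((2 + n) * c₁) (((2 + n) C 2) * c₀)) ⟩
  ℤ.- sign k ℤ.* (+ ((2 + n) * c₁) ℤ.+ + (((2 + n) C 2) * c₀))
    ≡⟨ cong₂ (λ s t → ℤ.- sign k ℤ.* (s ℤ.+ t)) (ℤₚ.pos-* (2 + n) c₁) (ℤₚ.pos-* ((2 + n) C 2) c₀) ⟩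
  ℤ.- sign k ℤ.* (+ (2 + n) ℤ.* + c₁ ℤ.+ + ((2 + n) C 2) ℤ.* + c₀)
    ≡⟨ distribute (sign k) (+ (2 + n)) (+ c₁) (+ ((2 + n) C 2)) (+ c₀) ⟩
  + (2 + n) ℤ.* (ℤ.- sign k ℤ.* + c₁) ℤ.- + ((2 + n) C 2) ℤ.* (sign k ℤ.* + c₀) ∎
  where
  open ≡-Reasoning
  c₀ c₁ : ℕ
  c₀ = coeff n k
  c₁ = coeff (1 + n) (suc k)
  distribute : ∀ s p x c y → ℤ.- s ℤ.* (p ℤ.* x ℤ.+ c ℤ.* y) ≡ p ℤ.* (ℤ.- s ℤ.* x) ℤ.- c ℤ.* (s ℤ.* y)
  distribute = ℤ-Solver.solve-∀

formula-as-long-Σ< : ∀ n N → n / 2 < N → formula n ≡ Σ< N (term n)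
formula-as-long-Σ< n N n/2<N = trans (formula-as-Σ< n)
  (sym (Σ<-stable (term n) (suc (n / 2)) N (λ k → term-vanishes n k) n/2<N))

n/2<1+d+n : ∀ n d → n / 2 < suc (d + n)
n/2<1+d+n n d = s≤s (ℕₚ.≤-trans (m/n≤m n 2) (ℕₚ.m≤n+m n d))

formula-rec : ∀ n → formula (2 + n) ≡ + (2 + n) ℤ.* formula (1 + n) ℤ.- + ((2 + n) C 2) ℤ.* formula n
formula-rec n = begin
  formula (2 + n)
    ≡⟨ formula-as-long-Σ< (2 + n) (3 + n) (n/2<1+d+n (2 + n) 0) ⟩
  Σ< (3 + n) (term (2 + n))
    ≡⟨ Σ<-recurrence (+ (2 + n)) (+ ((2 + n) C 2)) (term (1 + n)) (term (2 + n)) (term n) (2 + n)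
                     first-terms (term-rec n) ⟩
  + (2 + n) ℤ.* Σ< (3 + n) (term (1 + n)) ℤ.- + ((2 + n) C 2) ℤ.* Σ< (2 + n) (term n)
    ≡⟨ sym (cong₂ (λ s t → + (2 + n) ℤ.* s ℤ.- + ((2 + n) C 2) ℤ.* t)
                  (formula-as-long-Σ< (1 + n) (3 + n) (n/2<1+d+n (1 + n) 1))
                  (formula-as-long-Σ< n (2 + n) (n/2<1+d+n n 1))) ⟩
  + (2 + n) ℤ.* formula (1 + n) ℤ.- + ((2 + n) C 2) ℤ.* formula n ∎
  where
  open ≡-Reasoning
  first-terms : term (2 + n) 0 ≡ + (2 + n) ℤ.* term (1 + n) 0
  first-terms = begin
    term (2 + n) 0                ≡⟨ term-zero (2 + n) ⟩
    + ((2 + n) * (1 + n) !)       ≡⟨ ℤₚ.pos-* (2 + n) ((1 + n) !) ⟩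
    + (2 + n) ℤ.* + ((1 + n) !)   ≡⟨ cong (+ (2 + n) ℤ.*_) (sym (term-zero (1 + n))) ⟩
    + (2 + n) ℤ.* term (1 + n) 0  ∎

formula≡χ : ∀ n → formula n ≡ χ n
formula≡χ zero          = refl
formula≡χ (suc zero)    = refl
formula≡χ (suc (suc n)) = trans (formula-rec n)
  (cong₂ (λ s t → + (2 + n) ℤ.* s ℤ.- + ((2 + n) C 2) ℤ.* t) (formula≡χ (suc n)) (formula≡χ n))

⊆-rank-≡ : ∀ {n} {p q : Subset n} → p ⊆ q → ∣ q ∣ ≤ ∣ p ∣ → p ≡ q
⊆-rank-≡ {p = []}          {[]}          p⊆q _ = refl
⊆-rank-≡ {p = outside ∷ p} {outside ∷ q} p⊆q r = cong (outside ∷_) (⊆-rank-≡ (Subsetₚ.drop-∷-⊆ p⊆q) r)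
⊆-rank-≡ {p = inside ∷ p}  {inside ∷ q}  p⊆q r = cong (inside ∷_) (⊆-rank-≡ (Subsetₚ.drop-∷-⊆ p⊆q) (ℕₚ.≤-pred r))
⊆-rank-≡ {p = outside ∷ p} {inside ∷ q}  p⊆q r =
  contradiction (ℕₚ.≤-trans r (Subsetₚ.p⊆q⇒∣p∣≤∣q∣ (Subsetₚ.drop-∷-⊆ p⊆q))) (ℕₚ.n≮n _)
⊆-rank-≡ {p = inside ∷ p}  {outside ∷ q} p⊆q r with () ← p⊆q Vec.here

⊆-rank-⊂ : ∀ {n} {p q : Subset n} → p ⊆ q → ∣ p ∣ < ∣ q ∣ → p ⊂ q
⊆-rank-⊂ {p = outside ∷ p} {outside ∷ q} p⊆q r = Subsetₚ.s⊂s (⊆-rank-⊂ (Subsetₚ.drop-∷-⊆ p⊆q) r)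
⊆-rank-⊂ {p = inside ∷ p}  {inside ∷ q}  p⊆q r = Subsetₚ.s⊂s (⊆-rank-⊂ (Subsetₚ.drop-∷-⊆ p⊆q) (ℕₚ.≤-pred r))
⊆-rank-⊂ {p = outside ∷ p} {inside ∷ q}  p⊆q r = Subsetₚ.out⊂in (Subsetₚ.drop-∷-⊆ p⊆q)
⊆-rank-⊂ {p = inside ∷ p}  {outside ∷ q} p⊆q r with () ← p⊆q Vec.here

rank-∪-∩ : ∀ {n} (p q : Subset n) → ∣ p ∪ q ∣ + ∣ p ∩ q ∣ ≡ ∣ p ∣ + ∣ q ∣
rank-∪-∩ []            []            = refl
rank-∪-∩ (outside ∷ p) (outside ∷ q) = rank-∪-∩ p q
rank-∪-∩ (inside ∷ p)  (outside ∷ q) = cong suc (rank-∪-∩ p q)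
rank-∪-∩ (outside ∷ p) (inside ∷ q)  =
  trans (cong suc (rank-∪-∩ p q)) (sym (ℕₚ.+-suc ∣ p ∣ ∣ q ∣))
rank-∪-∩ (inside ∷ p)  (inside ∷ q)  =
  cong suc (trans (ℕₚ.+-suc ∣ p ∪ q ∣ ∣ p ∩ q ∣)
                  (trans (cong suc (rank-∪-∩ p q)) (sym (ℕₚ.+-suc ∣ p ∣ ∣ q ∣))))

⋃ : ∀ {n} → Subset n → List (Subset n) → Subset n
⋃ u X = foldr _∪_ u X

u⊆⋃ : ∀ {n} (u : Subset n) X → u ⊆ ⋃ u X
u⊆⋃ u []      = Subsetₚ.⊆-refl
u⊆⋃ u (x ∷ X) = Subsetₚ.⊆-trans (u⊆⋃ u X) (Subsetₚ.q⊆p∪q x (⋃ u X))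

∈⇒⊆⋃ : ∀ {n} (u : Subset n) X {x} → x ∈ X → x ⊆ ⋃ u X
∈⇒⊆⋃ u (y ∷ X) (here refl) = Subsetₚ.p⊆p∪q (⋃ u X)
∈⇒⊆⋃ u (y ∷ X) (there x∈X) = Subsetₚ.⊆-trans (∈⇒⊆⋃ u X x∈X) (Subsetₚ.q⊆p∪q y (⋃ u X))

⋃-least : ∀ {n} (u : Subset n) X {z} → u ⊆ z → (∀ {x} → x ∈ X → x ⊆ z) → ⋃ u X ⊆ z
⋃-least u []      u⊆z X⊆z = u⊆z
⋃-least u (x ∷ X) u⊆z X⊆z x∈ with Subsetₚ.x∈p∪q⁻ x (⋃ u X) x∈
... | inj₁ ∈x = X⊆z (here refl) ∈x
... | inj₂ ∈⋃ = ⋃-least u X u⊆z (X⊆z ∘ there) ∈⋃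

_⋖_ : ∀ {n} → Subset n → Subset n → Set
u ⋖ x = u ⊆ x × ∣ x ∣ ≡ suc ∣ u ∣

covers-meet : ∀ {n} {u x y : Subset n} → u ⋖ x → u ⋖ y → x ≢ y → x ∩ y ≡ u
covers-meet {u = u} {x} {y} (u⊆x , ∣x∣) (u⊆y , ∣y∣) x≢y with suc ∣ u ∣ ℕ.≤? ∣ x ∩ y ∣
... | yes big = contradiction (trans (sym meet≡x) meet≡y) x≢y
  where
  meet≡x : x ∩ y ≡ x
  meet≡x = ⊆-rank-≡ (Subsetₚ.p∩q⊆p x y) (subst (_≤ ∣ x ∩ y ∣) (sym ∣x∣) big)
  meet≡y : x ∩ y ≡ y
  meet≡y = ⊆-rank-≡ (Subsetₚ.p∩q⊆q x y) (subst (_≤ ∣ x ∩ y ∣) (sym ∣y∣) big)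
... | no small = sym (⊆-rank-≡ (λ i∈u → Subsetₚ.x∈p∩q⁺ (u⊆x i∈u , u⊆y i∈u)) (ℕₚ.≤-pred (ℕₚ.≰⇒> small)))

cover-meet-⋃ : ∀ {n} {u x : Subset n} (Y : List (Subset n)) → u ⋖ x → x ∉ Y →
  (∀ {y} → y ∈ Y → u ⋖ y) → x ∩ ⋃ u Y ≡ u
cover-meet-⋃ {u = u} {x} []      u⋖x x∉Y Y-covers =
  Subsetₚ.⊆-antisym (Subsetₚ.p∩q⊆q x u) (λ i∈u → Subsetₚ.x∈p∩q⁺ (proj₁ u⋖x i∈u , i∈u))
cover-meet-⋃ {u = u} {x} (y ∷ Y) u⋖x x∉Y Y-covers = begin
  x ∩ (y ∪ ⋃ u Y)          ≡⟨ Subsetₚ.∩-distribˡ-∪ x y (⋃ u Y) ⟩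
  (x ∩ y) ∪ (x ∩ ⋃ u Y)    ≡⟨ cong₂ _∪_ (covers-meet u⋖x (Y-covers (here refl)) (x∉Y ∘ here))
                                        (cover-meet-⋃ Y u⋖x (x∉Y ∘ there) (Y-covers ∘ there)) ⟩
  u ∪ u                    ≡⟨ Subsetₚ.∪-idem u ⟩
  u                        ∎
  where open ≡-Reasoning

rank-⋃-covers : ∀ {n} (u : Subset n) (X : List (Subset n)) → Unique X →
  (∀ {x} → x ∈ X → u ⋖ x) → ∣ ⋃ u X ∣ ≡ ∣ u ∣ + length X
rank-⋃-covers u []      _            _        = sym (ℕₚ.+-identityʳ ∣ u ∣)
rank-⋃-covers u (x ∷ X) (x∉X′ ∷ uniq) X-covers = ℕₚ.+-cancelʳ-≡ ∣ u ∣ _ _ (begin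
  (∣ x ∪ v ∣ + ∣ u ∣)              ≡⟨ cong (λ w → ∣ x ∪ v ∣ + ∣ w ∣) (sym meet) ⟩
  (∣ x ∪ v ∣ + ∣ x ∩ v ∣)          ≡⟨ rank-∪-∩ x v ⟩
  (∣ x ∣ + ∣ v ∣)                  ≡⟨ cong₂ _+_ (proj₂ (X-covers (here refl))) (rank-⋃-covers u X uniq (X-covers ∘ there)) ⟩
  (suc ∣ u ∣ + (∣ u ∣ + length X)) ≡⟨ rearrange ∣ u ∣ (length X) ⟩
  (∣ u ∣ + suc (length X) + ∣ u ∣) ∎)
  where
  open ≡-Reasoning
  v : Subset _
  v = ⋃ u X
  meet : x ∩ v ≡ u
  meet = cover-meet-⋃ X (X-covers (here refl)) (Uniqueₚ.Unique[x∷xs]⇒x∉xs (x∉X′ ∷ uniq)) (X-covers ∘ there)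
  rearrange : ∀ a b → suc a + (a + b) ≡ a + suc b + a
  rearrange = ℕ-Solver.solve-∀

atLevel : ∀ {n} → ℕ → Subset n → Subset n → Bool
atLevel ℓ u x = does (u ⊆? x) ∧ (∣ x ∣ ℕ.≡ᵇ ℓ)

atLevel-sound : ∀ {n ℓ} {u x : Subset n} → T (atLevel ℓ u x) → u ⊆ x × ∣ x ∣ ≡ ℓ
atLevel-sound {ℓ = ℓ} {u} {x} t with u ⊆? x
... | yes u⊆x = u⊆x , ℕₚ.≡ᵇ⇒≡ ∣ x ∣ ℓ t
... | no _    = ⊥-elim t

atLevel-complete : ∀ {n ℓ} {u x : Subset n} → u ⊆ x → ∣ x ∣ ≡ ℓ → T (atLevel ℓ u x)
atLevel-complete {ℓ = ℓ} {u} {x} u⊆x ∣x∣≡ℓ with u ⊆? x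
... | yes _   = ℕₚ.≡⇒≡ᵇ ∣ x ∣ ℓ ∣x∣≡ℓ
... | no u⊈x  = u⊈x u⊆x

level : ∀ {n} → ℕ → Subset n → List (Subset n)
level {n} ℓ u = filterᵇ (atLevel ℓ u) (allElems n)

level-∈ : ∀ {n ℓ} {u x : Subset n} → x ∈ level ℓ u → u ⊆ x × ∣ x ∣ ≡ ℓ
level-∈ {n} x∈ = atLevel-sound (proj₂ (∈-filter⁻ _ {xs = allElems n} x∈))

filterᵇ-none : (P : A → Bool) (xs : List A) → (∀ x → ¬ T (P x)) → filterᵇ P xs ≡ []
filterᵇ-none P xs never = filter-none (T? ∘ P) (All.universal never xs)

level-below : ∀ {n ℓ} (u : Subset n) → ℓ < ∣ u ∣ → level ℓ u ≡ []
level-below {n} {ℓ} u ℓ<∣u∣ = filterᵇ-none (atLevel ℓ u) (allElems n) never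
  where
  never : ∀ x → ¬ T (atLevel ℓ u x)
  never x t = let (u⊆x , ∣x∣≡ℓ) = atLevel-sound {u = u} {x} t in
    ℕₚ.<⇒≱ ℓ<∣u∣ (subst (∣ u ∣ ≤_) ∣x∣≡ℓ (Subsetₚ.p⊆q⇒∣p∣≤∣q∣ u⊆x))

filterᵇ-map : (P : B → Bool) (f : A → B) (xs : List A) →
  filterᵇ P (map f xs) ≡ map f (filterᵇ (P ∘ f) xs)
filterᵇ-map P f []       = refl
filterᵇ-map P f (x ∷ xs) with P (f x)
... | true  = cong (f x ∷_) (filterᵇ-map P f xs)
... | false = filterᵇ-map P f xs

filterᵇ-allElems : ∀ {n} (P : Subset (suc n) → Bool) →
  filterᵇ P (allElems (suc n))
    ≡ map (outside ∷_) (filterᵇ (P ∘ (outside ∷_)) (allElems n))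
   ++ map (inside ∷_) (filterᵇ (P ∘ (inside ∷_)) (allElems n))
filterᵇ-allElems {n} P = trans (filter-++ _ (map (outside ∷_) (allElems n)) _)
  (cong₂ _++_ (filterᵇ-map P (outside ∷_) (allElems n)) (filterᵇ-map P (inside ∷_) (allElems n)))

level-self : ∀ {n} (u : Subset n) → level ∣ u ∣ u ≡ u ∷ []
level-self []            = refl
level-self (outside ∷ u) = begin
  level ∣ u ∣ (outside ∷ u)
    ≡⟨ filterᵇ-allElems (atLevel ∣ u ∣ (outside ∷ u)) ⟩
  map (outside ∷_) (level ∣ u ∣ u) ++ map (inside ∷_) (filterᵇ (atLevel ∣ u ∣ (outside ∷ u) ∘ (inside ∷_)) (allElems _))
    ≡⟨ cong₂ (λ s t → map (outside ∷_) s ++ map (inside ∷_) t) (level-self u) (filterᵇ-none _ (allElems _) never) ⟩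
  (outside ∷ u) ∷ [] ∎
  where
  open ≡-Reasoning
  never : ∀ z → ¬ T (atLevel ∣ u ∣ (outside ∷ u) (inside ∷ z))
  never z t = let (u⊆z , ∣z∣) = atLevel-sound {u = outside ∷ u} {x = inside ∷ z} t in
    ℕₚ.<⇒≱ (ℕₚ.≤-reflexive ∣z∣) (Subsetₚ.p⊆q⇒∣p∣≤∣q∣ (Subsetₚ.drop-∷-⊆ u⊆z))
level-self (inside ∷ u)  = begin
  level (suc ∣ u ∣) (inside ∷ u)
    ≡⟨ filterᵇ-allElems (atLevel (suc ∣ u ∣) (inside ∷ u)) ⟩
  map (outside ∷_) (filterᵇ (λ _ → false) (allElems _)) ++ map (inside ∷_) (level ∣ u ∣ u)
    ≡⟨ cong₂ (λ s t → map (outside ∷_) s ++ map (inside ∷_) t) (filterᵇ-none _ (allElems _) (λ _ ())) (level-self u) ⟩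
  (inside ∷ u) ∷ [] ∎
  where open ≡-Reasoning

level-covers-length : ∀ {n} (u : Subset n) → length (level (suc ∣ u ∣) u) ≡ n ∸ ∣ u ∣
level-covers-length []            = refl
level-covers-length {suc n} (outside ∷ u) = begin
  length (level (suc ∣ u ∣) (outside ∷ u))
    ≡⟨ cong length (filterᵇ-allElems (atLevel (suc ∣ u ∣) (outside ∷ u))) ⟩
  length (map (outside ∷_) (level (suc ∣ u ∣) u) ++ map (inside ∷_) (level ∣ u ∣ u))
    ≡⟨ length-++ (map (outside ∷_) (level (suc ∣ u ∣) u)) ⟩
  length (map (outside ∷_) (level (suc ∣ u ∣) u)) + length (map (inside ∷_) (level ∣ u ∣ u))
    ≡⟨ cong₂ _+_ (length-map (outside ∷_) (level (suc ∣ u ∣) u)) (length-map (inside ∷_) (level ∣ u ∣ u)) ⟩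
  length (level (suc ∣ u ∣) u) + length (level ∣ u ∣ u)
    ≡⟨ cong₂ _+_ (level-covers-length u) (cong length (level-self u)) ⟩
  (n ∸ ∣ u ∣) + 1
    ≡⟨ ℕₚ.+-comm (n ∸ ∣ u ∣) 1 ⟩
  suc (n ∸ ∣ u ∣)
    ≡⟨ sym (ℕₚ.+-∸-assoc 1 (Subsetₚ.∣p∣≤n u)) ⟩
  suc n ∸ ∣ u ∣ ∎
  where open ≡-Reasoning
level-covers-length {suc n} (inside ∷ u)  = begin
  length (level (suc (suc ∣ u ∣)) (inside ∷ u))
    ≡⟨ cong length (filterᵇ-allElems (atLevel (suc (suc ∣ u ∣)) (inside ∷ u))) ⟩
  length (map (outside ∷_) (filterᵇ (λ _ → false) (allElems n)) ++ map (inside ∷_) (level (suc ∣ u ∣) u))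
    ≡⟨ cong (λ s → length (map (outside ∷_) s ++ map (inside ∷_) (level (suc ∣ u ∣) u)))
            (filterᵇ-none _ (allElems n) (λ _ ())) ⟩
  length (map (inside ∷_) (level (suc ∣ u ∣) u))
    ≡⟨ length-map (inside ∷_) (level (suc ∣ u ∣) u) ⟩
  length (level (suc ∣ u ∣) u)
    ≡⟨ level-covers-length u ⟩
  n ∸ ∣ u ∣ ∎
  where open ≡-Reasoning

allElems-unique : ∀ n → Unique (allElems n)
allElems-unique zero    = [] ∷ []
allElems-unique (suc n) = Uniqueₚ.++⁺ (Uniqueₚ.map⁺ Vecₚ.∷-injectiveʳ (allElems-unique n))
                                      (Uniqueₚ.map⁺ Vecₚ.∷-injectiveʳ (allElems-unique n))
                                      disjoint
  where
  disjoint : ∀ {v} → ¬ (v ∈ map (outside ∷_) (allElems n) × v ∈ map (inside ∷_) (allElems n))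
  disjoint (v∈out , v∈in) with ∈-map⁻ (outside ∷_) v∈out | ∈-map⁻ (inside ∷_) v∈in
  ... | _ , _ , refl | _ , _ , ()

level-unique : ∀ {n} ℓ (u : Subset n) → Unique (level ℓ u)
level-unique {n} ℓ u = Uniqueₚ.filter⁺ (T? ∘ atLevel ℓ u) (allElems-unique n)

∈-sublists⁻ : (y : A) (ys : List A) {X : List A} → X ∈ sublists (y ∷ ys) →
  X ∈ sublists ys ⊎ ∃[ X′ ] (X′ ∈ sublists ys × X ≡ y ∷ X′)
∈-sublists⁻ y ys X∈ with ∈-++⁻ (sublists ys) X∈
... | inj₁ X∈ys  = inj₁ X∈ys
... | inj₂ X∈y∷ = inj₂ (∈-map⁻ (y ∷_) X∈y∷)

sublists-⊆ : (xs : List A) {X : List A} → X ∈ sublists xs → ∀ {x} → x ∈ X → x ∈ xs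
sublists-⊆ []       (here refl) ()
sublists-⊆ (y ∷ ys) X∈ x∈X with ∈-sublists⁻ y ys X∈
... | inj₁ X∈ys = there (sublists-⊆ ys X∈ys x∈X)
... | inj₂ (X′ , X′∈ys , refl) with x∈X
...   | here x≡y   = here x≡y
...   | there x∈X′ = there (sublists-⊆ ys X′∈ys x∈X′)

sublists-unique : (xs : List A) {X : List A} → Unique xs → X ∈ sublists xs → Unique X
sublists-unique []       _                 (here refl) = []
sublists-unique (y ∷ ys) (y∉ys ∷ uniq) X∈ with ∈-sublists⁻ y ys X∈
... | inj₁ X∈ys               = sublists-unique ys uniq X∈ys
... | inj₂ (X′ , X′∈ys , refl) =
  All.tabulate (λ x∈X′ → All.lookup y∉ys (sublists-⊆ ys X′∈ys x∈X′)) ∷ sublists-unique ys uniq X′∈ys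

_≺_ : ∀ {n} → List (Subset n) → List (Subset n) → Set
X ≺ Y = ∀ {a b} → a ∈ X → b ∈ Y → a ⊂ b

-- The cell condition of Hom(C_{m−1}, B_n) on (X_0, …, X_{m−1}): X_p ≺ X_q whenever p < q.
StrictChain : ∀ {n m} → Vec (List (Subset n)) m → Set
StrictChain X = ∀ {p q} → p Fin.< q → lookup X p ≺ lookup X q

allL-sound : (P : A → Bool) (xs : List A) → T (allL P xs) → ∀ {x} → x ∈ xs → T (P x)
allL-sound P (y ∷ xs) t (here refl) = proj₁ (Equivalence.to T-∧ t)
allL-sound P (y ∷ xs) t (there x∈) = allL-sound P xs (proj₂ (Equivalence.to (T-∧ {P y}) t)) x∈

allL-complete : (P : A → Bool) (xs : List A) → (∀ {x} → x ∈ xs → T (P x)) → T (allL P xs)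
allL-complete P []       all = _
allL-complete P (y ∷ xs) all = Equivalence.from T-∧ (all (here refl) , allL-complete P xs (all ∘ there))

guarded-sound : ∀ {P : Set} (P? : Dec P) {b} → T (if ⌊ P? ⌋ then b else true) → P → T b
guarded-sound (yes _) t _ = t
guarded-sound (no ¬p) _ p = contradiction p ¬p

guarded-complete : ∀ {P : Set} (P? : Dec P) {b} → (P → T b) → T (if ⌊ P? ⌋ then b else true)
guarded-complete (yes p) f = f p
guarded-complete (no _)  _ = _

below? : ∀ {n} → List (Subset n) → List (Subset n) → Bool
below? X Y = allL (λ a → allL (λ b → ⌊ a ⊂? b ⌋) Y) X

below?-sound : ∀ {n} (X Y : List (Subset n)) → T (below? X Y) → X ≺ Y
below?-sound X Y t a∈ b∈ = toWitness (allL-sound _ Y (allL-sound _ X t a∈) b∈)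

below?-complete : ∀ {n} (X Y : List (Subset n)) → X ≺ Y → T (below? X Y)
below?-complete X Y X≺Y =
  allL-complete _ X (λ a∈ → allL-complete _ Y (λ b∈ → fromWitness (X≺Y a∈ b∈)))

pairTest : ∀ {n m} → Vec (List (Subset n)) m → Fin m → Fin m → Bool
pairTest X p q = if ⌊ p Fin.<? q ⌋ then below? (lookup X p) (lookup X q) else true

isCell-sound : ∀ n (X : Vec (List (Subset n)) (suc n)) → T (isCell n X) → StrictChain X
isCell-sound n X t {p} {q} p<q = below?-sound (lookup X p) (lookup X q)
  (guarded-sound (p Fin.<? q) (allL-sound (pairTest X p) (allFin (suc n))
    (allL-sound (λ p → allL (pairTest X p) (allFin (suc n))) (allFin (suc n)) t (∈-allFin p)) (∈-allFin q)) p<q)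

isCell-complete : ∀ n (X : Vec (List (Subset n)) (suc n)) → StrictChain X → T (isCell n X)
isCell-complete n X chain =
  allL-complete (λ p → allL (pairTest X p) (allFin (suc n))) (allFin (suc n)) λ {p} _ →
  allL-complete (pairTest X p) (allFin (suc n)) λ {q} _ →
  guarded-complete (p Fin.<? q) (λ p<q → below?-complete (lookup X p) (lookup X q) (chain p<q))

chain-head : ∀ {n m} {X : List (Subset n)} {W : Vec (List (Subset n)) m} →
  StrictChain (X ∷ W) → ∀ q → X ≺ lookup W q
chain-head chain q = chain {zero} {suc q} (s≤s z≤n)

chain-tail : ∀ {n m} {X : List (Subset n)} {W : Vec (List (Subset n)) m} →
  StrictChain (X ∷ W) → StrictChain W
chain-tail chain {p} {q} p<q = chain {suc p} {suc q} (s≤s p<q)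

chain-∷ : ∀ {n m} {X : List (Subset n)} {W : Vec (List (Subset n)) m} →
  (∀ q → X ≺ lookup W q) → StrictChain W → StrictChain (X ∷ W)
chain-∷ head tail {zero}  {suc q} _         = head q
chain-∷ head tail {suc p} {suc q} (s≤s p<q) = tail p<q

graded : ∀ {n m} → ℕ → Subset n → Vec (List (Subset n)) m → Bool
graded ℓ u []      = true
graded ℓ u (X ∷ W) = allL (atLevel ℓ u) X ∧ graded (suc ℓ) (⋃ u X) W

allAtLevel-∈ : ∀ {n} ℓ (u : Subset n) X → T (allL (atLevel ℓ u) X) → ∀ {x} → x ∈ X → u ⊆ x × ∣ x ∣ ≡ ℓ
allAtLevel-∈ ℓ u X t {x} x∈X = atLevel-sound {u = u} {x} (allL-sound (atLevel ℓ u) X t x∈X)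

graded-bounds : ∀ {n m} ℓ (u : Subset n) (W : Vec (List (Subset n)) m) → T (graded ℓ u W) →
  ∀ q {z} → z ∈ lookup W q → u ⊆ z × ℓ ≤ ∣ z ∣
graded-bounds ℓ u (X ∷ W) t zero z∈X =
  let (u⊆z , ∣z∣≡ℓ) = allAtLevel-∈ ℓ u X (proj₁ (Equivalence.to T-∧ t)) z∈X
  in u⊆z , ℕₚ.≤-reflexive (sym ∣z∣≡ℓ)
graded-bounds ℓ u (X ∷ W) t (suc q) z∈ =
  let (⋃⊆z , ℓ<∣z∣) = graded-bounds (suc ℓ) (⋃ u X) W (proj₂ (Equivalence.to (T-∧ {allL (atLevel ℓ u) X}) t)) q z∈
  in Subsetₚ.⊆-trans (u⊆⋃ u X) ⋃⊆z , ℕₚ.<⇒≤ ℓ<∣z∣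

-- Graded tuples are strict chains: a ∈ X_p lies below the join that every b ∈ X_q
-- contains, and has smaller rank.
graded⇒chain : ∀ {n m} ℓ (u : Subset n) (W : Vec (List (Subset n)) m) → T (graded ℓ u W) → StrictChain W
graded⇒chain ℓ u (X ∷ W) t = chain-∷ head (graded⇒chain (suc ℓ) (⋃ u X) W tail-graded)
  where
  head-graded : T (allL (atLevel ℓ u) X)
  head-graded = proj₁ (Equivalence.to (T-∧ {allL (atLevel ℓ u) X}) t)
  tail-graded : T (graded (suc ℓ) (⋃ u X) W)
  tail-graded = proj₂ (Equivalence.to (T-∧ {allL (atLevel ℓ u) X}) t)
  head : ∀ q → X ≺ lookup W q
  head q a∈X b∈ =
    let (⋃⊆b , ℓ<∣b∣) = graded-bounds (suc ℓ) (⋃ u X) W tail-graded q b∈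
        (_ , ∣a∣≡ℓ)   = allAtLevel-∈ ℓ u X head-graded a∈X
    in ⊆-rank-⊂ (Subsetₚ.⊆-trans (∈⇒⊆⋃ u X a∈X) ⋃⊆b) (subst (_< _) (sym ∣a∣≡ℓ) ℓ<∣b∣)

NonEmptyEntries : ∀ {n m} → Vec (List (Subset n)) m → Set
NonEmptyEntries W = ∀ q → 1 ≤ length (lookup W q)

element-of : ∀ {n} {Y : List (Subset n)} → 1 ≤ length Y → ∃[ y ] y ∈ Y
element-of {Y = y ∷ _} _ = y , here refl

-- In a strict chain (X, Y_1, …, Y_m) of nonempty entries the elements of X have rank ≤ n − m,
-- since each later entry raises the rank.
chain-rank-bound : ∀ {n m} (X : List (Subset n)) (W : Vec (List (Subset n)) m) →
  StrictChain (X ∷ W) → NonEmptyEntries W → ∀ {x} → x ∈ X → ∣ x ∣ + m ≤ n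
chain-rank-bound X []      _     _        {x} _   = ℕₚ.≤-trans (ℕₚ.≤-reflexive (ℕₚ.+-identityʳ ∣ x ∣)) (Subsetₚ.∣p∣≤n x)
chain-rank-bound {n} {suc m} X (Y ∷ W) chain nonempty {x} x∈X =
  let (y , y∈Y) = element-of (nonempty zero) in begin
  (∣ x ∣ + suc m)   ≡⟨ ℕₚ.+-suc ∣ x ∣ m ⟩
  (suc ∣ x ∣ + m)   ≤⟨ ℕₚ.+-monoˡ-≤ m (Subsetₚ.p⊂q⇒∣p∣<∣q∣ (chain-head chain zero x∈X y∈Y)) ⟩
  (∣ y ∣ + m)       ≤⟨ chain-rank-bound Y W (chain-tail chain) (nonempty ∘ suc) y∈Y ⟩
  n                 ∎
  where open ℕₚ.≤-Reasoning

chain-first-level : ∀ {n m} ℓ (u : Subset n) (X : List (Subset n)) (W : Vec (List (Subset n)) m) →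
  ℓ + m ≡ n → StrictChain (X ∷ W) → NonEmptyEntries W →
  (∀ {x} → x ∈ X → u ⊆ x) → (∀ {x} → x ∈ X → ℓ ≤ ∣ x ∣) → T (allL (atLevel ℓ u) X)
chain-first-level {m = m} ℓ u X W ℓ+m≡n chain nonempty above low = allL-complete (atLevel ℓ u) X
  λ {x} x∈X → atLevel-complete (above x∈X) (ℕₚ.≤-antisym
    (ℕₚ.+-cancelʳ-≤ m ∣ x ∣ ℓ (subst (∣ x ∣ + m ≤_) (sym ℓ+m≡n) (chain-rank-bound X W chain nonempty x∈X)))
    (low x∈X))

chain⇒graded : ∀ {n m} ℓ (u : Subset n) (X : List (Subset n)) (W : Vec (List (Subset n)) m) →
  ℓ + m ≡ n → StrictChain (X ∷ W) → NonEmptyEntries (X ∷ W) →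
  (∀ q {z} → z ∈ lookup (X ∷ W) q → u ⊆ z) → (∀ {x} → x ∈ X → ℓ ≤ ∣ x ∣) →
  T (graded ℓ u (X ∷ W))
chain⇒graded ℓ u X [] ℓ+m≡n chain nonempty above low =
  Equivalence.from T-∧ (chain-first-level ℓ u X [] ℓ+m≡n chain (nonempty ∘ suc) (above zero) low , _)
chain⇒graded ℓ u X (Y ∷ W) ℓ+m≡n chain nonempty above low =
  Equivalence.from T-∧ (chain-first-level ℓ u X (Y ∷ W) ℓ+m≡n chain (nonempty ∘ suc) (above zero) low ,
    chain⇒graded (suc ℓ) (⋃ u X) Y W (trans (sym (ℕₚ.+-suc ℓ _)) ℓ+m≡n) (chain-tail chain) (nonempty ∘ suc)
      above-⋃ low-next)
  where
  above-⋃ : ∀ q {z} → z ∈ lookup (Y ∷ W) q → ⋃ u X ⊆ z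
  above-⋃ q z∈ = ⋃-least u X (above (suc q) z∈) (λ x∈X → proj₁ (chain-head chain q x∈X z∈))
  low-next : ∀ {y} → y ∈ Y → suc ℓ ≤ ∣ y ∣
  low-next y∈Y = let (x , x∈X) = element-of (nonempty zero) in
    ℕₚ.≤-<-trans (low x∈X) (Subsetₚ.p⊂q⇒∣p∣<∣q∣ (chain-head chain zero x∈X y∈Y))

T-ext : ∀ {a b} → (T a → T b) → (T b → T a) → a ≡ b
T-ext {false} {false} _ _ = refl
T-ext {false} {true}  _ f = ⊥-elim (f _)
T-ext {true}  {false} f _ = ⊥-elim (f _)
T-ext {true}  {true}  _ _ = refl

isCell≡graded : ∀ n (X : Vec (List (Subset n)) (suc n)) → NonEmptyEntries X → isCell n X ≡ graded 0 ⊥ X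
isCell≡graded n (X ∷ W) nonempty = T-ext
  (λ t → chain⇒graded 0 ⊥ X W refl (isCell-sound n (X ∷ W) t) nonempty (λ _ _ → Subsetₚ.⊥⊆) (λ _ → z≤n))
  (λ t → isCell-complete n (X ∷ W) (graded⇒chain 0 ⊥ (X ∷ W) t))

tuples-∈ : (xs : List A) (m : ℕ) {W : Vec A m} → W ∈ tuples xs m → ∀ q → lookup W q ∈ xs
tuples-∈ xs (suc m) W∈ q with ∈-concat⁻′ (map (λ x → map (x ∷_) (tuples xs m)) xs) W∈
... | Ws , W∈Ws , Ws∈ with ∈-map⁻ (λ x → map (x ∷_) (tuples xs m)) Ws∈
... | x , x∈xs , refl with ∈-map⁻ (x ∷_) W∈Ws
... | W′ , W′∈ , refl with q
... | zero  = x∈xs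
... | suc q = tuples-∈ xs m W′∈ q

dimension : ∀ {n m} → Vec (List (Subset n)) m → ℕ
dimension = Vec.foldr (λ _ → ℕ) (λ Xp d → (length Xp ∸ 1) + d) 0

-- Φ m ℓ u is the alternating count of the graded m-tuples from level ℓ over u,
-- i.e. of the cells of the part of Hom(B_n) lying above u from rank ℓ on.
Φ : ∀ {n} → ℕ → ℕ → Subset n → ℤ
Φ {n} m ℓ u = Σ (tuples (nonemptySubsetsOfB n) m) (λ W → if graded ℓ u W then sign (dimension W) else + 0)

does-≟-true : ∀ b → does (b Bool.≟ true) ≡ b
does-≟-true false = refl
does-≟-true true  = refl

eulerHom≡Φ : ∀ n → eulerHom n ≡ Φ (suc n) 0 (⊥ {n})
eulerHom≡Φ n = begin
  eulerHom n
    ≡⟨ Σ-filter (λ X → isCell n X Bool.≟ true) tuples-n (sign ∘ dim) ⟩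
  Σ tuples-n (λ X → if does (isCell n X Bool.≟ true) then sign (dim X) else + 0)
    ≡⟨ Σ-cong tuples-n {g = λ X → if graded 0 ⊥ X then sign (dim X) else + 0} (λ {X} X∈ → cong (λ b → if b then sign (dim X) else + 0)
         (trans (does-≟-true (isCell n X)) (isCell≡graded n X (nonempty X∈)))) ⟩
  Φ (suc n) 0 (⊥ {n}) ∎
  where
  open ≡-Reasoning
  tuples-n : List (Vec (List (Subset n)) (suc n))
  tuples-n = tuples (nonemptySubsetsOfB n) (suc n)
  nonempty : ∀ {X} → X ∈ tuples-n → NonEmptyEntries X
  nonempty X∈ q = proj₂ (∈-filter⁻ (λ Y → 1 ℕ.≤? length Y) {xs = sublists (allElems n)}
                                   (tuples-∈ (nonemptySubsetsOfB n) (suc n) X∈ q))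

sign-+ : ∀ a b → sign (a + b) ≡ sign a ℤ.* sign b
sign-+ zero    b = sym (ℤₚ.*-identityˡ (sign b))
sign-+ (suc a) b = trans (cong ℤ.-_ (sign-+ a b)) (ℤₚ.neg-distribˡ-* (sign a) (sign b))

Σ-factor-sign : (a : Bool) (good : A → Bool) (d : ℕ) (dimA : A → ℕ) (xs : List A) →
  Σ xs (λ W → if a ∧ good W then sign (d + dimA W) else + 0)
    ≡ (if a then sign d ℤ.* Σ xs (λ W → if good W then sign (dimA W) else + 0) else + 0)
Σ-factor-sign false good d dimA xs = Σ-zero xs
Σ-factor-sign true  good d dimA xs =
  trans (Σ-cong xs (λ {W} _ → factor W)) (Σ-*ˡ (sign d) xs (λ W → if good W then sign (dimA W) else + 0))
  where
  factor : ∀ W → (if good W then sign (d + dimA W) else + 0)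
                 ≡ sign d ℤ.* (if good W then sign (dimA W) else + 0)
  factor W with good W
  ... | true  = sign-+ d (dimA W)
  ... | false = sym (ℤₚ.*-zeroʳ (sign d))

if-swap : ∀ (a b : Bool) (x : ℤ) →
  (if a then (if b then x else + 0) else + 0) ≡ (if b then (if a then x else + 0) else + 0)
if-swap false false x = refl
if-swap false true  x = refl
if-swap true  false x = refl
if-swap true  true  x = refl

contribution : ∀ {n} → ℕ → ℕ → Subset n → List (Subset n) → ℤ
contribution m ℓ u X = if does (1 ℕ.≤? length X) then sign (length X ∸ 1) ℤ.* Φ m (suc ℓ) (⋃ u X) else + 0

Φ-expand : ∀ {n} m ℓ (u : Subset n) → Φ (suc m) ℓ u ≡ Σ (sublists (level ℓ u)) (contribution m ℓ u)
Φ-expand {n} m ℓ u = begin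
  Φ (suc m) ℓ u
    ≡⟨ Σ-concatMap (λ X → map (X ∷_) rest) S counted ⟩
  Σ S (λ X → Σ (map (X ∷_) rest) counted)
    ≡⟨ Σ-cong S (λ {X} _ → trans (Σ-map (X ∷_) rest counted)
         (Σ-factor-sign (allL (atLevel ℓ u) X) (graded (suc ℓ) (⋃ u X)) (length X ∸ 1) dimension rest)) ⟩
  Σ S (restrict (atLevel ℓ u) weighted)
    ≡⟨ Σ-filter (λ X → 1 ℕ.≤? length X) (sublists (allElems n)) (restrict (atLevel ℓ u) weighted) ⟩
  Σ (sublists (allElems n)) (λ X → if does (1 ℕ.≤? length X) then restrict (atLevel ℓ u) weighted X else + 0)
    ≡⟨ Σ-cong (sublists (allElems n)) (λ {X} _ → if-swap (does (1 ℕ.≤? length X)) (allL (atLevel ℓ u) X) (weighted X)) ⟩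
  Σ (sublists (allElems n)) (restrict (atLevel ℓ u) (contribution m ℓ u))
    ≡⟨ Σ-sublists-filter (atLevel ℓ u) (allElems n) (contribution m ℓ u) ⟩
  Σ (sublists (level ℓ u)) (contribution m ℓ u) ∎
  where
  open ≡-Reasoning
  S : List (List (Subset n))
  S = nonemptySubsetsOfB n
  rest : List (Vec (List (Subset n)) m)
  rest = tuples S m
  counted : Vec (List (Subset n)) (suc m) → ℤ
  counted W = if graded ℓ u W then sign (dimension W) else + 0
  weighted : List (Subset n) → ℤ
  weighted X = sign (length X ∸ 1) ℤ.* Φ m (suc ℓ) (⋃ u X)

-- Above rank ℓ there is nothing left to choose once u has passed it.
Φ-above : ∀ {n} m ℓ (u : Subset n) → m + ℓ ≡ suc n → ℓ < ∣ u ∣ → Φ m ℓ u ≡ + 0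
Φ-above {n} zero    ℓ u refl ℓ<∣u∣ = ⊥-elim (ℕₚ.≤⇒≯ (Subsetₚ.∣p∣≤n u) (ℕₚ.<-trans (ℕₚ.n<1+n n) ℓ<∣u∣))
Φ-above     (suc m) ℓ u _    ℓ<∣u∣ =
  trans (Φ-expand m ℓ u) (cong (λ L → Σ (sublists L) (contribution m ℓ u)) (level-below u ℓ<∣u∣))

-- At its own rank u is the only choice, and it contributes with sign +1.
Φ-skip : ∀ {n} m (u : Subset n) → Φ (suc m) ∣ u ∣ u ≡ Φ m (suc ∣ u ∣) u
Φ-skip m u = begin
  Φ (suc m) ∣ u ∣ u                                       ≡⟨ Φ-expand m ∣ u ∣ u ⟩
  Σ (sublists (level ∣ u ∣ u)) (contribution m ∣ u ∣ u)  ≡⟨ cong (λ L → Σ (sublists L) (contribution m ∣ u ∣ u)) (level-self u) ⟩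
  + 0 ℤ.+ (+ 1 ℤ.* Φ m (suc ∣ u ∣) (u ∪ u) ℤ.+ + 0)       ≡⟨ cong (λ v → + 0 ℤ.+ (+ 1 ℤ.* Φ m (suc ∣ u ∣) v ℤ.+ + 0)) (Subsetₚ.∪-idem u) ⟩
  + 0 ℤ.+ (+ 1 ℤ.* Φ m (suc ∣ u ∣) u ℤ.+ + 0)             ≡⟨ simplify (Φ m (suc ∣ u ∣) u) ⟩
  Φ m (suc ∣ u ∣) u                                       ∎
  where
  open ≡-Reasoning
  simplify : ∀ x → + 0 ℤ.+ (+ 1 ℤ.* x ℤ.+ + 0) ≡ x
  simplify = ℤ-Solver.solve-∀

rank-⋃-sublevel : ∀ {n} (u : Subset n) {X} → X ∈ sublists (level (suc ∣ u ∣) u) → ∣ ⋃ u X ∣ ≡ ∣ u ∣ + length X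
rank-⋃-sublevel u {X} X∈ = rank-⋃-covers u X
  (sublists-unique (level (suc ∣ u ∣) u) (level-unique (suc ∣ u ∣) u) X∈)
  (λ x∈X → level-∈ (sublists-⊆ (level (suc ∣ u ∣) u) X∈ x∈X))

-- The value of a contribution just below the level, as a function of the size k of
-- the first entry: χ m for k = 1, −χ (m−1) for k = 2 and 0 otherwise.
sizeWeight : ℤ → ℤ → ℕ → ℤ
sizeWeight c c₋ (suc zero)       = c
sizeWeight c c₋ (suc (suc zero)) = ℤ.- c₋
sizeWeight c c₋ _                = + 0

next-level : ∀ {n} m (u : Subset n) → suc m + suc ∣ u ∣ ≡ suc n → m + (2 + ∣ u ∣) ≡ suc n
next-level m u eq = trans (ℕₚ.+-suc m (suc ∣ u ∣)) eq

mutual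
  Φ-below : ∀ {n} m ℓ (u : Subset n) → m + ℓ ≡ suc n → suc ∣ u ∣ ≡ ℓ → Φ m ℓ u ≡ χ m
  Φ-below     zero    ℓ u _      _    = refl
  Φ-below {n} (suc m) ℓ u m+ℓ≡1+n refl = begin
    Φ (suc m) (suc ∣ u ∣) u
      ≡⟨ Φ-expand m (suc ∣ u ∣) u ⟩
    Σ (sublists L) (contribution m (suc ∣ u ∣) u)
      ≡⟨ Σ-cong (sublists L) (contribution-by-size m u m+ℓ≡1+n) ⟩
    Σ (sublists L) (sizeWeight (χ m) (χ₋ m) ∘ length)
      ≡⟨ Σ-sublists-by-size L (sizeWeight (χ m) (χ₋ m)) (λ _ → refl) ⟩
    + 0 ℤ.+ + length L ℤ.* χ m ℤ.+ + (length L C 2) ℤ.* ℤ.- χ₋ m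
      ≡⟨ cong (λ k → + 0 ℤ.+ + k ℤ.* χ m ℤ.+ + (k C 2) ℤ.* ℤ.- χ₋ m) covers ⟩
    + 0 ℤ.+ + suc m ℤ.* χ m ℤ.+ + (suc m C 2) ℤ.* ℤ.- χ₋ m
      ≡⟨ rearrange (+ suc m) (χ m) (+ (suc m C 2)) (χ₋ m) ⟩
    χ (suc m) ∎
    where
    open ≡-Reasoning
    L : List (Subset n)
    L = level (suc ∣ u ∣) u
    covers : length L ≡ suc m
    covers = begin
      length L                 ≡⟨ level-covers-length u ⟩
      n ∸ ∣ u ∣                ≡⟨ cong (_∸ ∣ u ∣) (trans (sym (ℕₚ.suc-injective m+ℓ≡1+n)) (ℕₚ.+-suc m ∣ u ∣)) ⟩
      suc m + ∣ u ∣ ∸ ∣ u ∣     ≡⟨ ℕₚ.m+n∸n≡m (suc m) ∣ u ∣ ⟩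
      suc m                    ∎
    rearrange : ∀ k c q c₋ → + 0 ℤ.+ k ℤ.* c ℤ.+ q ℤ.* ℤ.- c₋ ≡ k ℤ.* c ℤ.- q ℤ.* c₋
    rearrange = ℤ-Solver.solve-∀

  Φ-at : ∀ {n} m ℓ (u : Subset n) → m + ℓ ≡ suc n → ∣ u ∣ ≡ ℓ → Φ m ℓ u ≡ χ₋ m
  Φ-at {n} zero    ℓ u refl ∣u∣≡1+n = contradiction (subst (_≤ n) ∣u∣≡1+n (Subsetₚ.∣p∣≤n u)) (ℕₚ.n≮n n)
  Φ-at     (suc m) ℓ u m+ℓ≡1+n refl =
    trans (Φ-skip m u) (Φ-below m (suc ∣ u ∣) u (trans (ℕₚ.+-suc m ∣ u ∣) m+ℓ≡1+n) refl)

  -- The contribution of a first entry of size k is sizeWeight (χ m) (χ₋ m) k, because its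
  -- join has rank |u| + k: one level up for k = 1, two for k = 2, too high for k ≥ 3.
  contribution-by-size : ∀ {n} m (u : Subset n) → suc m + suc ∣ u ∣ ≡ suc n →
    ∀ {X} → X ∈ sublists (level (suc ∣ u ∣) u) →
    contribution m (suc ∣ u ∣) u X ≡ sizeWeight (χ m) (χ₋ m) (length X)
  contribution-by-size m u _   {[]}                  _  = refl
  contribution-by-size m u eq {X@(_ ∷ [])}         X∈ =
    trans (ℤₚ.*-identityˡ _) (Φ-below m (2 + ∣ u ∣) (⋃ u X) (next-level m u eq)
      (cong suc (trans (rank-⋃-sublevel u X∈) (ℕₚ.+-comm ∣ u ∣ 1))))
  contribution-by-size m u eq {X@(_ ∷ _ ∷ [])}     X∈ =
    trans (ℤₚ.-1*i≡-i _) (cong ℤ.-_ (Φ-at m (2 + ∣ u ∣) (⋃ u X) (next-level m u eq)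
      (trans (rank-⋃-sublevel u X∈) (ℕₚ.+-comm ∣ u ∣ 2))))
  contribution-by-size m u eq {X@(_ ∷ _ ∷ _ ∷ X′)} X∈ =
    trans (cong (sign (length X ∸ 1) ℤ.*_) (Φ-above m (2 + ∣ u ∣) (⋃ u X) (next-level m u eq) too-high))
          (ℤₚ.*-zeroʳ (sign (length X ∸ 1)))
    where
    too-high : 2 + ∣ u ∣ < ∣ ⋃ u X ∣
    too-high = ℕₚ.≤-trans (ℕₚ.≤-reflexive (ℕₚ.+-comm 3 ∣ u ∣))
      (ℕₚ.≤-trans (ℕₚ.+-monoʳ-≤ ∣ u ∣ (s≤s (s≤s (s≤s z≤n)))) (ℕₚ.≤-reflexive (sym (rank-⋃-sublevel u X∈))))

-- Theorem 6.2 (the argument does not need the hypothesis n ≥ 1).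
theorem6p2 : (n : ℕ) → 1 ≤ n → eulerHom n ≡ formula n
theorem6p2 n _ = begin
  eulerHom n              ≡⟨ eulerHom≡Φ n ⟩
  Φ (suc n) 0 (⊥ {n})     ≡⟨ Φ-at (suc n) 0 ⊥ (ℕₚ.+-identityʳ (suc n)) (Subsetₚ.∣⊥∣≡0 n) ⟩
  χ n                     ≡⟨ sym (formula≡χ n) ⟩
  formula n               ∎
  where open ≡-Reasoning
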